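{- Let $G$ be a simple graph with $n$ vertices. Suppose $G$ has a spanning subgraph whose connected components are $H_1,\dots,H_p,H_{p+1}$, where $H_i$ is a triangle for every $1\leq i\leq p-1$ and $H_p,H_{p+1}\in\{K_2,K_3\}$. Then $\chi(\mathrm{KG}(G,P_2))=|E(G)|-\lfloor \tfrac{2}{3}n\rfloor$.
   Context: $P_2$ is the path with $2$ edges (3 vertices). $\mathrm{KG}(G,P_2)$ is the graph whose vertices are the edge sets of the subgraphs of $G$ isomorphic to $P_2$ (i.e., unordered pairs of edges sharing a vertex), two vertices being adjacent iff these edge sets are disjoint. -}

module Defs where

open import Data.Nat using (ℕ; zero; suc; _+_; _*_; _∸_; _≤_; _<_; _<ᵇ_)
open import Data.Nat.DivMod using (_/_)
open import Data.Bool using (Bool; true; false; if_then_else_; _∧_)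
open import Data.Fin using (Fin; toℕ)
open import Data.Fin.Properties using () renaming (_≟_ to _≟ᶠ_)
open import Data.List using (List; length; filter; map; allFin)
open import Data.Nat.ListAction using (sum)
open import Data.Product using (Σ; _×_; _,_)
open import Data.Sum using (_⊎_)
open import Relation.Nullary using (¬_)
open import Relation.Binary.PropositionalEquality using (_≡_; _≢_)

record SimpleGraph (n : ℕ) : Set where
  field
    adj    : Fin n → Fin n → Bool
    sym    : ∀ u v → adj u v ≡ adj v u
    irrefl : ∀ u → adj u u ≡ false
open SimpleGraph public

module _ {n : ℕ} (G : SimpleGraph n) where

  record Edge : Set where
    constructor mkEdge
    field
      lo      : Fin n
      hi      : Fin n
      ordered : toℕ lo < toℕ hi
      isEdge  : adj G lo hi ≡ true
  open Edge public

  edgeCount : ℕ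
  edgeCount = sum (map (λ u → sum (map (λ v →
                 if (toℕ u <ᵇ toℕ v) ∧ adj G u v then 1 else 0) (allFin n))) (allFin n))

  SameEdge : Edge → Edge → Set
  SameEdge e f = lo e ≡ lo f × hi e ≡ hi f

  -- strict lexicographic order on edges (used to pick one representative
  -- of each unordered pair of edges)
  EdgeLt : Edge → Edge → Set
  EdgeLt e f = toℕ (lo e) < toℕ (lo f) ⊎ (lo e ≡ lo f × toℕ (hi e) < toℕ (hi f))

  ShareVertex : Edge → Edge → Set
  ShareVertex e f = lo e ≡ lo f ⊎ lo e ≡ hi f ⊎ hi e ≡ lo f ⊎ hi e ≡ hi f

  -- Vertices of KG(G,P₂): edge sets {e₁,e₂} of subgraphs isomorphic to P₂,
  -- i.e. unordered pairs of distinct edges sharing a vertex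
  -- (represented with e₁ < e₂ lexicographically).
  record P2Sub : Set where
    constructor mkP2
    field
      e₁    : Edge
      e₂    : Edge
      lt    : EdgeLt e₁ e₂
      share : ShareVertex e₁ e₂
  open P2Sub public

  DisjointP2 : P2Sub → P2Sub → Set
  DisjointP2 x y =
    ¬ SameEdge (e₁ x) (e₁ y) × ¬ SameEdge (e₁ x) (e₂ y) ×
    ¬ SameEdge (e₂ x) (e₁ y) × ¬ SameEdge (e₂ x) (e₂ y)

Colorable : (V : Set) → (V → V → Set) → ℕ → Set
Colorable V Adj k = Σ (V → Fin k) λ c → ∀ x y → Adj x y → c x ≢ c y

IsChromaticNumber : (V : Set) → (V → V → Set) → ℕ → Set
IsChromaticNumber V Adj k = Colorable V Adj k × (∀ m → Colorable V Adj m → k ≤ m)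

classSize : {n m : ℕ} → (Fin n → Fin m) → Fin m → ℕ
classSize {n} f i = length (filter (λ v → f v ≟ᶠ i) (allFin n))

-- G has a spanning subgraph H whose connected components are
-- H₁,…,H_{p+1} (indexed 0..p here by comp), with H_i a triangle for
-- i ≤ p-1 (0-indexed: i < p-1) and H_p, H_{p+1} ∈ {K₂, K₃}.
-- H's components are given by the labelling comp: H is the disjoint union
-- of the complete graphs on the classes of comp.
HasCliqueFactor : {n : ℕ} → SimpleGraph n → ℕ → Set
HasCliqueFactor {n} G p =
  Σ (SimpleGraph n) λ H → Σ (Fin n → Fin (suc p)) λ comp →
    (∀ u v → adj H u v ≡ true → adj G u v ≡ true) ×
    (∀ u v → adj H u v ≡ true → comp u ≡ comp v) ×
    (∀ u v → u ≢ v → comp u ≡ comp v → adj H u v ≡ true) ×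
    (∀ i → toℕ i < p ∸ 1 → classSize comp i ≡ 3) ×
    (∀ i → p ∸ 1 ≤ toℕ i → classSize comp i ≡ 2 ⊎ classSize comp i ≡ 3)

module Submission where

-- Lower bound: a color class of KG(G,P₂) is an intersecting family of copies of P₂. If all its
-- members share an edge e, delete e and recolor G − e with one color fewer. Otherwise the class
-- lies in a triangle and has at most three members; as a vertex of degree d is the centre of
-- d(d−1)/2 ≥ (3d−4)/2 copies of P₂, double counting gives 3|E| ≤ 3χ + 2n, i.e. χ ≥ |E| − ⌊2n/3⌋.
-- Upper bound: order the vertices and call an edge free if it joins consecutive vertices of one
-- clique of the factor. There are at least n − (p+1) ≥ ⌊2n/3⌋ free edges, and the others color
-- KG(G,P₂): a copy of P₂ takes one of its edges leaving its clique or, if it lies in a triangle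
-- a < b < c, the edge ac.

open import Defs renaming (sym to adj-sym)
open import Data.Bool using (Bool; true; false; if_then_else_; _∧_; not; T)
open import Data.Empty using (⊥; ⊥-elim)
open import Data.Fin using (Fin; toℕ; punchOut; inject≤) renaming (zero to fz; suc to fs)
open import Data.Bool.Properties
  using (T-≡; T-∧; ¬-not; ∧-identityʳ; ∧-conicalˡ; ∧-conicalʳ) renaming (_≟_ to _≟ᵇ_)
open import Axiom.UniquenessOfIdentityProofs using (module Decidable⇒UIP)
open import Data.Fin.Properties
  using (suc-injective; toℕ-injective; punchOut-injective; inject≤-injective; any?) renaming (_≟_ to _≟ᶠ_)
open import Data.List using (List; map; allFin; tabulate; filter; length; _++_; cartesianProduct)
import Data.Nat.ListAction as List
open import Data.List.Properties using (map-tabulate; filter-++; length-++)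
open import Data.List.Relation.Unary.Any using (index)
open import Data.List.Membership.Propositional.Properties using (∈-filter⁺; ∈-cartesianProduct⁺; ∈-allFin)
open import Data.List.Membership.Propositional using (_∈_)
open import Data.List.Membership.Setoid.Properties using (index-injective)
open import Data.Nat using (ℕ; zero; suc; _+_; _*_; _∸_; _≤_; _<_; z≤n; s≤s; s≤s⁻¹; _<ᵇ_; _≤?_; _<?_)
open import Data.Nat.DivMod using (_/_; m<n*o⇒m/o<n; m*n/n≡m; /-monoˡ-≤)
open import Data.Nat.Properties hiding (suc-injective)
open import Data.Product using (Σ; _×_; _,_; proj₁; proj₂; ∃)
open import Data.Sum using (_⊎_; inj₁; inj₂; [_,_]′)
open import Function using (_∘_; id; Equivalence)
open import Relation.Binary using (tri<; tri≈; tri>)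
open import Relation.Nullary using (¬_; Dec; yes; no; does; _×-dec_; ¬?)
open import Relation.Nullary.Decidable using (T?; dec-true; _⊎-dec_; decidable-stable; ¬¬-excluded-middle)
open import Relation.Binary.PropositionalEquality
open import Data.Nat.Solver using (module +-*-Solver)
open +-*-Solver
open import Algebra.Properties.Semiring.Sum +-*-semiring
  using (sum; sum-syntax; sum-cong-≗; ∑-distrib-+; ∑-comm; *-distribˡ-sum)

-- Finite sums and indicators

∑-mono-≤ : ∀ {n} {f g : Fin n → ℕ} → (∀ i → f i ≤ g i) → sum f ≤ sum g
∑-mono-≤ {zero}  f≤g = z≤n
∑-mono-≤ {suc n} f≤g = +-mono-≤ (f≤g fz) (∑-mono-≤ (f≤g ∘ fs))

∑-const : ∀ n c → ∑[ i < n ] c ≡ n * c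
∑-const zero    c = refl
∑-const (suc n) c = cong (c +_) (∑-const n c)

∑-zero : ∀ {n} {f : Fin n → ℕ} → (∀ i → f i ≡ 0) → sum f ≡ 0
∑-zero {zero}  f≡0 = refl
∑-zero {suc n} f≡0 = cong₂ _+_ (f≡0 fz) (∑-zero (f≡0 ∘ fs))

term≤∑ : ∀ {n} (f : Fin n → ℕ) j → f j ≤ sum f
term≤∑ f fz     = m≤m+n _ _
term≤∑ f (fs j) = ≤-trans (term≤∑ (f ∘ fs) j) (m≤n+m _ _)

∑-positive : ∀ {n} (f : Fin n → ℕ) → 0 < sum f → ∃ λ i → 0 < f i
∑-positive {suc n} f ∑f>0 with f fz in eq
... | suc _ = fz , subst (0 <_) (sym eq) (s≤s z≤n)
... | zero with ∑-positive (f ∘ fs) ∑f>0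
...   | i , fi>0 = fs i , fi>0

∑-≤1 : ∀ {n} (f : Fin n → ℕ) → (∀ i → f i ≤ 1) →
       (∀ i j → 0 < f i → 0 < f j → i ≡ j) → sum f ≤ 1
∑-≤1 {zero}  f f≤1 unique = z≤n
∑-≤1 {suc n} f f≤1 unique with f fz in eq
... | zero  = ∑-≤1 (f ∘ fs) (f≤1 ∘ fs) λ i j fi>0 fj>0 → suc-injective (unique (fs i) (fs j) fi>0 fj>0)
... | suc k = begin
    suc k + sum (f ∘ fs) ≡⟨ cong (suc k +_) (∑-zero rest≡0) ⟩
    suc k + 0            ≡⟨ +-identityʳ _ ⟩
    suc k                ≡⟨ eq ⟨
    f fz                 ≤⟨ f≤1 fz ⟩
    1                    ∎
  where
  open ≤-Reasoning
  f0>0 : 0 < f fz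
  f0>0 = subst (0 <_) (sym eq) (s≤s z≤n)
  rest≡0 : ∀ i → f (fs i) ≡ 0
  rest≡0 i with f (fs i) in eqᵢ
  ... | zero  = refl
  ... | suc _ with unique fz (fs i) f0>0 (subst (0 <_) (sym eqᵢ) (s≤s z≤n))
  ...   | ()

𝟙 : {P : Set} → Dec P → ℕ
𝟙 d = if does d then 1 else 0

𝟙≤1 : {P : Set} (d : Dec P) → 𝟙 d ≤ 1
𝟙≤1 (yes _) = s≤s z≤n
𝟙≤1 (no _)  = z≤n

𝟙-yes : {P : Set} (d : Dec P) → P → 𝟙 d ≡ 1
𝟙-yes (yes _) _ = refl
𝟙-yes (no ¬p) p = ⊥-elim (¬p p)

𝟙-no : {P : Set} (d : Dec P) → ¬ P → 𝟙 d ≡ 0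
𝟙-no (yes p) ¬p = ⊥-elim (¬p p)
𝟙-no (no _)  _  = refl

𝟙-positive : {P : Set} (d : Dec P) → 0 < 𝟙 d → P
𝟙-positive (yes p) _ = p

does-cong : {P Q : Set} (d : Dec P) (e : Dec Q) → (P → Q) → (Q → P) → does d ≡ does e
does-cong (yes _) (yes _) _   _   = refl
does-cong (yes p) (no ¬q) p→q _   = ⊥-elim (¬q (p→q p))
does-cong (no ¬p) (yes q) _   q→p = ⊥-elim (¬p (q→p q))
does-cong (no _)  (no _)  _   _   = refl

𝟙-cong : {P Q : Set} (d : Dec P) (e : Dec Q) → (P → Q) → (Q → P) → 𝟙 d ≡ 𝟙 e
𝟙-cong d e p→q q→p = cong (if_then 1 else 0) (does-cong d e p→q q→p)

𝟙-+-𝟙-¬ : {P : Set} (d : Dec P) → 𝟙 d + 𝟙 (¬? d) ≡ 1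
𝟙-+-𝟙-¬ (yes _) = refl
𝟙-+-𝟙-¬ (no _)  = refl

𝟙-split : {A B : Set} (a : Dec A) (b : Dec B) → (B → A) → 𝟙 a ≡ 𝟙 (a ×-dec ¬? b) + 𝟙 b
𝟙-split (yes _)  (yes _) _   = refl
𝟙-split (yes _)  (no _)  _   = refl
𝟙-split (no _)   (no _)  _   = refl
𝟙-split (no ¬a)  (yes b) b→a = ⊥-elim (¬a (b→a b))

𝟙-⊎ : {P A B : Set} (p : Dec P) (a : Dec A) (b : Dec B) → (P → A ⊎ B) → 𝟙 p ≤ 𝟙 a + 𝟙 b
𝟙-⊎ (no _)  _       _       _   = z≤n
𝟙-⊎ (yes _) (yes _) _       _   = s≤s z≤n
𝟙-⊎ (yes _) (no _)  (yes _) _   = s≤s z≤n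
𝟙-⊎ (yes p) (no ¬a) (no ¬b) p→ = ⊥-elim ([ ¬a , ¬b ]′ (p→ p))

∑-𝟙-≟ : ∀ n (j : Fin n) → ∑[ i < n ] 𝟙 (i ≟ᶠ j) ≡ 1
∑-𝟙-≟ (suc n) fz     = cong suc (∑-zero {n} λ i → 𝟙-no (fs i ≟ᶠ fz) λ ())
∑-𝟙-≟ (suc n) (fs j) = trans (sum-cong-≗ λ i → 𝟙-cong (fs i ≟ᶠ fs j) (i ≟ᶠ j) suc-injective (cong fs))
                             (∑-𝟙-≟ n j)

∑-𝟙-≟ˡ : ∀ n (j : Fin n) → ∑[ i < n ] 𝟙 (j ≟ᶠ i) ≡ 1
∑-𝟙-≟ˡ n j = trans (sum-cong-≗ λ i → 𝟙-cong (j ≟ᶠ i) (i ≟ᶠ j) sym sym) (∑-𝟙-≟ n j)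

∑∑-𝟙-≟ : ∀ {n} (a b : Fin n) → ∑[ u < n ] ∑[ w < n ] 𝟙 ((u ≟ᶠ a) ×-dec (w ≟ᶠ b)) ≡ 1
∑∑-𝟙-≟ {n} a b = trans (sum-cong-≗ {n} row) (∑-𝟙-≟ n a)
  where
  row : ∀ u → ∑[ w < n ] 𝟙 ((u ≟ᶠ a) ×-dec (w ≟ᶠ b)) ≡ 𝟙 (u ≟ᶠ a)
  row u with u ≟ᶠ a
  ... | yes _ = ∑-𝟙-≟ n b
  ... | no _  = ∑-zero {n} λ _ → refl

listSum-allFin : ∀ n (f : Fin n → ℕ) → List.sum (map f (allFin n)) ≡ sum f
listSum-allFin n f = trans (cong List.sum (map-tabulate id f)) (listSum-tabulate n f)
  where
  listSum-tabulate : ∀ n (f : Fin n → ℕ) → List.sum (tabulate f) ≡ sum f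
  listSum-tabulate zero    f = refl
  listSum-tabulate (suc n) f = cong (f fz +_) (listSum-tabulate n (f ∘ fs))

length-filter-tabulate : ∀ {A : Set} {P : A → Set} (P? : ∀ a → Dec (P a)) {n} (g : Fin n → A) →
                         length (filter P? (tabulate g)) ≡ ∑[ v < n ] 𝟙 (P? (g v))
length-filter-tabulate P? {zero}  g = refl
length-filter-tabulate P? {suc n} g with P? (g fz)
... | yes _ = cong suc (length-filter-tabulate P? (g ∘ fs))
... | no _  = length-filter-tabulate P? (g ∘ fs)

length-filter-cartesianProduct : ∀ {n} {P : Fin n × Fin n → Set} (P? : ∀ x → Dec (P x)) →
  length (filter P? (cartesianProduct (allFin n) (allFin n))) ≡ ∑[ u < n ] ∑[ w < n ] 𝟙 (P? (u , w))
length-filter-cartesianProduct {n} P? = rows id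
  where
  rows : ∀ {k} (g : Fin k → Fin n) →
         length (filter P? (cartesianProduct (tabulate g) (allFin n))) ≡ ∑[ u < k ] ∑[ w < n ] 𝟙 (P? (g u , w))
  rows {zero}  g = refl
  rows {suc k} g = begin
      length (filter P? (map (g fz ,_) (allFin n) ++ cartesianProduct (tabulate (g ∘ fs)) (allFin n)))
    ≡⟨ cong length (filter-++ P? (map (g fz ,_) (allFin n)) _) ⟩
      length (filter P? (map (g fz ,_) (allFin n)) ++ filter P? (cartesianProduct (tabulate (g ∘ fs)) (allFin n)))
    ≡⟨ length-++ (filter P? (map (g fz ,_) (allFin n))) ⟩
      length (filter P? (map (g fz ,_) (allFin n))) + length (filter P? (cartesianProduct (tabulate (g ∘ fs)) (allFin n)))
    ≡⟨ cong₂ _+_ (trans (cong (length ∘ filter P?) (map-tabulate id (g fz ,_)))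
                        (length-filter-tabulate P? (g fz ,_)))
                 (rows (g ∘ fs)) ⟩
      ∑[ u < suc k ] ∑[ w < n ] 𝟙 (P? (g u , w)) ∎
    where open ≡-Reasoning

<⇒≢ᶠ : ∀ {n} {u v : Fin n} → toℕ u < toℕ v → u ≢ v
<⇒≢ᶠ u<v u≡v = <-irrefl (cong toℕ u≡v) u<v

<⇒<ᵇ≡true : ∀ {m n} → m < n → (m <ᵇ n) ≡ true
<⇒<ᵇ≡true m<n = Equivalence.to T-≡ (<⇒<ᵇ m<n)

≮⇒<ᵇ≡false : ∀ {m n} → ¬ m < n → (m <ᵇ n) ≡ false
≮⇒<ᵇ≡false {m} {n} m≮n = ¬-not (m≮n ∘ <ᵇ⇒< m n ∘ Equivalence.from T-≡)

count : ∀ {n} → (Fin n → Bool) → ℕ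
count {n} p = ∑[ a < n ] 𝟙 (T? (p a))

pairCount : ∀ {n} → (Fin n → Bool) → ℕ
pairCount {n} p = ∑[ a < n ] ∑[ b < n ] 𝟙 (T? ((toℕ a <ᵇ toℕ b) ∧ p a ∧ p b))

count+2*pairCount≡count² : ∀ {n} (p : Fin n → Bool) → count p + 2 * pairCount p ≡ count p * count p
count+2*pairCount≡count² {zero}  p = refl
count+2*pairCount≡count² {suc n} p with p fz
... | false = trans (cong (λ t → count (p ∘ fs) + 2 * (t + pairCount (p ∘ fs))) (∑-zero {n} λ _ → refl))
                    (count+2*pairCount≡count² (p ∘ fs))
... | true  = begin
    suc (d + 2 * (d + pairCount (p ∘ fs)))
  ≡⟨ solve 2 (λ d q → con 1 :+ (d :+ con 2 :* (d :+ q)) := con 1 :+ (d :+ d :+ (d :+ con 2 :* q))) refl d _ ⟩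
    suc (d + d + (d + 2 * pairCount (p ∘ fs)))
  ≡⟨ cong (λ t → suc (d + d + t)) (count+2*pairCount≡count² (p ∘ fs)) ⟩
    suc (d + d + d * d)
  ≡⟨ solve 1 (λ d → con 1 :+ (d :+ d :+ d :* d) := (con 1 :+ d) :* (con 1 :+ d)) refl d ⟩
    suc d * suc d ∎
  where
  open ≡-Reasoning
  d = count (p ∘ fs)

4*d≤d²+4 : ∀ d → 4 * d ≤ d * d + 4
4*d≤d²+4 0 = z≤n
4*d≤d²+4 1 = s≤s (s≤s (s≤s (s≤s z≤n)))
4*d≤d²+4 (suc (suc k)) =
  subst₂ _≤_ (solve 1 (λ k → k :* con 4 :+ con 8 := con 4 :* (con 2 :+ k)) refl k)
             (solve 1 (λ k → k :* k :+ (k :* con 4 :+ con 8) := (con 2 :+ k) :* (con 2 :+ k) :+ con 4) refl k)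
             (m≤n+m (k * 4 + 8) (k * k))

3*count≤2*pairCount+4 : ∀ {n} (p : Fin n → Bool) → 3 * count p ≤ 2 * pairCount p + 4
3*count≤2*pairCount+4 p = +-cancelˡ-≤ d _ _
  (subst₂ _≤_ (solve 1 (λ d → con 4 :* d := d :+ con 3 :* d) refl d)
              (trans (cong (_+ 4) (sym (count+2*pairCount≡count² p))) (+-assoc d _ 4))
              (4*d≤d²+4 d))
  where d = count p

-- Graphs and copies of P₂

module _ {n : ℕ} (G : SimpleGraph n) where

  isEdgeᵇ : Fin n → Fin n → Bool
  isEdgeᵇ u v = (toℕ u <ᵇ toℕ v) ∧ adj G u v

  edgeCount≡∑∑ : edgeCount G ≡ ∑[ u < n ] ∑[ v < n ] 𝟙 (T? (isEdgeᵇ u v))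
  edgeCount≡∑∑ = trans (listSum-allFin n _) (sum-cong-≗ {n} λ u → listSum-allFin n _)

  edge⇒isEdgeᵇ : (e : Edge G) → T (isEdgeᵇ (lo e) (hi e))
  edge⇒isEdgeᵇ e = Equivalence.from T-∧ (<⇒<ᵇ (ordered e) , Equivalence.from T-≡ (isEdge e))

  degree : Fin n → ℕ
  degree v = count (adj G v)

  adj⇒≢ : ∀ {u v} → adj G u v ≡ true → u ≢ v
  adj⇒≢ {u} uv refl with trans (sym uv) (irrefl G u)
  ... | ()

  private
    adjacency-split : ∀ v u → 𝟙 (T? (adj G v u)) ≡ 𝟙 (T? (isEdgeᵇ v u)) + 𝟙 (T? (isEdgeᵇ u v))
    adjacency-split v u with <-cmp (toℕ v) (toℕ u)
    ... | tri< v<u _ u≮v rewrite <⇒<ᵇ≡true v<u | ≮⇒<ᵇ≡false u≮v = sym (+-identityʳ _)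
    ... | tri≈ _ v≡u _ rewrite toℕ-injective v≡u | ≮⇒<ᵇ≡false (<-irrefl (refl {x = toℕ u}))
                             | irrefl G u = refl
    ... | tri> v≮u _ u<v rewrite <⇒<ᵇ≡true u<v | ≮⇒<ᵇ≡false v≮u | adj-sym G v u = refl

  handshake : ∑[ v < n ] degree v ≡ 2 * edgeCount G
  handshake = begin
      ∑[ v < n ] ∑[ u < n ] 𝟙 (T? (adj G v u))
    ≡⟨ sum-cong-≗ {n} (λ v → trans (sum-cong-≗ {n} (adjacency-split v)) (∑-distrib-+ {n} _ _)) ⟩
      ∑[ v < n ] (∑[ u < n ] 𝟙 (T? (isEdgeᵇ v u)) + ∑[ u < n ] 𝟙 (T? (isEdgeᵇ u v)))
    ≡⟨ ∑-distrib-+ {n} _ _ ⟩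
      E + ∑[ v < n ] ∑[ u < n ] 𝟙 (T? (isEdgeᵇ u v))
    ≡⟨ cong (E +_) (∑-comm {n} {n} (λ v u → 𝟙 (T? (isEdgeᵇ u v)))) ⟩
      E + E
    ≡⟨ cong (λ t → t + t) (sym edgeCount≡∑∑) ⟩
      edgeCount G + edgeCount G
    ≡⟨ cong (edgeCount G +_) (sym (+-identityʳ _)) ⟩
      2 * edgeCount G ∎
    where
    open ≡-Reasoning
    E = ∑[ u < n ] ∑[ v < n ] 𝟙 (T? (isEdgeᵇ u v))

module _ {n : ℕ} {G : SimpleGraph n} where

  edge-≡ : {e f : Edge G} → lo e ≡ lo f → hi e ≡ hi f → e ≡ f
  edge-≡ {mkEdge l h o i} {mkEdge .l .h o′ i′} refl refl
    rewrite <-irrelevant o o′ | Decidable⇒UIP.≡-irrelevant _≟ᵇ_ i i′ = refl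

  _≟ₑ_ : (e f : Edge G) → Dec (e ≡ f)
  e ≟ₑ f with lo e ≟ᶠ lo f | hi e ≟ᶠ hi f
  ... | yes l | yes h = yes (edge-≡ l h)
  ... | no l≢ | _     = no (l≢ ∘ cong lo)
  ... | _     | no h≢ = no (h≢ ∘ cong hi)

  sameEdge⇒≡ : {e f : Edge G} → SameEdge G e f → e ≡ f
  sameEdge⇒≡ (l , h) = edge-≡ l h

  infix 4 _∈ₚ_ _⊆ₚ_

  _∈ₚ_ : Edge G → P2Sub G → Set
  h ∈ₚ x = h ≡ e₁ x ⊎ h ≡ e₂ x

  _∈ₚ?_ : ∀ h x → Dec (h ∈ₚ x)
  h ∈ₚ? x with h ≟ₑ e₁ x | h ≟ₑ e₂ x
  ... | yes h≡e₁ | _        = yes (inj₁ h≡e₁)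
  ... | no _     | yes h≡e₂ = yes (inj₂ h≡e₂)
  ... | no h≢e₁  | no h≢e₂  = no [ h≢e₁ , h≢e₂ ]′

  _⊆ₚ_ : P2Sub G → P2Sub G → Set
  w ⊆ₚ x = e₁ w ∈ₚ x × e₂ w ∈ₚ x

  _⊆ₚ?_ : ∀ w x → Dec (w ⊆ₚ x)
  w ⊆ₚ? x with e₁ w ∈ₚ? x | e₂ w ∈ₚ? x
  ... | yes e₁∈x | yes e₂∈x = yes (e₁∈x , e₂∈x)
  ... | no e₁∉x  | _        = no (e₁∉x ∘ proj₁)
  ... | _        | no e₂∉x  = no (e₂∉x ∘ proj₂)

  e₁≢e₂ : (x : P2Sub G) → e₁ x ≢ e₂ x
  e₁≢e₂ x e₁≡e₂ with lt x
  ... | inj₁ lo< = <-irrefl (cong (toℕ ∘ lo) e₁≡e₂) lo<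
  ... | inj₂ (_ , hi<) = <-irrefl (cong (toℕ ∘ hi) e₁≡e₂) hi<

  ∈ₚ-pair : ∀ {a b h} x → a ≢ b → a ∈ₚ x → b ∈ₚ x → h ∈ₚ x → h ≡ a ⊎ h ≡ b
  ∈ₚ-pair x a≢b (inj₁ refl) (inj₁ refl) _           = ⊥-elim (a≢b refl)
  ∈ₚ-pair x a≢b (inj₂ refl) (inj₂ refl) _           = ⊥-elim (a≢b refl)
  ∈ₚ-pair x a≢b (inj₁ refl) (inj₂ refl) (inj₁ refl) = inj₁ refl
  ∈ₚ-pair x a≢b (inj₁ refl) (inj₂ refl) (inj₂ refl) = inj₂ refl
  ∈ₚ-pair x a≢b (inj₂ refl) (inj₁ refl) (inj₁ refl) = inj₂ refl
  ∈ₚ-pair x a≢b (inj₂ refl) (inj₁ refl) (inj₂ refl) = inj₁ refl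

  ⊆ₚ-pair : ∀ {a b} w x → a ≢ b → a ∈ₚ w → b ∈ₚ w → a ∈ₚ x → b ∈ₚ x → w ⊆ₚ x
  ⊆ₚ-pair w x a≢b a∈w b∈w a∈x b∈x = in-x (∈ₚ-pair w a≢b a∈w b∈w (inj₁ refl)) ,
                                     in-x (∈ₚ-pair w a≢b a∈w b∈w (inj₂ refl))
    where
    in-x : ∀ {h} → h ≡ _ ⊎ h ≡ _ → h ∈ₚ x
    in-x (inj₁ refl) = a∈x
    in-x (inj₂ refl) = b∈x

  another-edge : ∀ y f → ∃ λ g → g ∈ₚ y × g ≢ f
  another-edge y f with e₁ y ≟ₑ f
  ... | no e₁≢f  = e₁ y , inj₁ refl , e₁≢f
  ... | yes e₁≡f = e₂ y , inj₂ refl , λ e₂≡f → e₁≢e₂ y (trans e₁≡f (sym e₂≡f))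

  record Meets (x y : P2Sub G) : Set where
    constructor meets
    field
      common : Edge G
      common∈ˡ : common ∈ₚ x
      common∈ʳ : common ∈ₚ y

  ¬disjoint⇒meets : ∀ x y → ¬ DisjointP2 G x y → Meets x y
  ¬disjoint⇒meets x y ¬disj with e₁ x ≟ₑ e₁ y | e₁ x ≟ₑ e₂ y | e₂ x ≟ₑ e₁ y | e₂ x ≟ₑ e₂ y
  ... | yes eq | _      | _      | _      = meets (e₁ x) (inj₁ refl) (inj₁ eq)
  ... | no _   | yes eq | _      | _      = meets (e₁ x) (inj₁ refl) (inj₂ eq)
  ... | no _   | no _   | yes eq | _      = meets (e₂ x) (inj₂ refl) (inj₁ eq)
  ... | no _   | no _   | no _   | yes eq = meets (e₂ x) (inj₂ refl) (inj₂ eq)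
  ... | no ne₁₁ | no ne₁₂ | no ne₂₁ | no ne₂₂ =
    ⊥-elim (¬disj ( ne₁₁ ∘ sameEdge⇒≡ , ne₁₂ ∘ sameEdge⇒≡
                  , ne₂₁ ∘ sameEdge⇒≡ , ne₂₂ ∘ sameEdge⇒≡))

  meets-pair : ∀ {a b} x {y} → a ≢ b → a ∈ₚ x → b ∈ₚ x → Meets x y → a ∈ₚ y ⊎ b ∈ₚ y
  meets-pair x a≢b a∈x b∈x (meets h h∈x h∈y) with ∈ₚ-pair x a≢b a∈x b∈x h∈x
  ... | inj₁ refl = inj₁ h∈y
  ... | inj₂ refl = inj₂ h∈y

  -- An intersecting family of pairs in which x = {e, f}, y ∌ e and z ∌ f must be the
  -- triangle x = {e, f}, y = {f, g}, z = {e, g}; nothing else meets all three sides.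
  triangle : ∀ {x y z w} → Meets x y → Meets x z → Meets y z → Meets x w → Meets y w → Meets z w →
             ¬ e₁ x ∈ₚ y → ¬ e₂ x ∈ₚ z → w ⊆ₚ x ⊎ w ⊆ₚ y ⊎ w ⊆ₚ z
  triangle {x} {y} {z} {w} xy xz yz xw yw zw e∉y f∉z = via-x (meets-pair x e≢f e∈x f∈x xw)
    where
    e = e₁ x
    f = e₂ x
    e≢f = e₁≢e₂ x
    e∈x : e ∈ₚ x
    e∈x = inj₁ refl
    f∈x : f ∈ₚ x
    f∈x = inj₂ refl
    f∈y : f ∈ₚ y
    f∈y = [ ⊥-elim ∘ e∉y , id ]′ (meets-pair x e≢f e∈x f∈x xy)
    e∈z : e ∈ₚ z
    e∈z = [ id , ⊥-elim ∘ f∉z ]′ (meets-pair x e≢f e∈x f∈x xz)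
    g = proj₁ (another-edge y f)
    g∈y = proj₁ (proj₂ (another-edge y f))
    g≢f = proj₂ (proj₂ (another-edge y f))
    e≢g : e ≢ g
    e≢g e≡g = e∉y (subst (_∈ₚ y) (sym e≡g) g∈y)
    g∈z : g ∈ₚ z
    g∈z = [ id , ⊥-elim ∘ f∉z ]′ (meets-pair y g≢f g∈y f∈y yz)
    R = w ⊆ₚ x ⊎ w ⊆ₚ y ⊎ w ⊆ₚ z
    via-y : e ∈ₚ w → g ∈ₚ w ⊎ f ∈ₚ w → R
    via-y e∈w (inj₁ g∈w) = inj₂ (inj₂ (⊆ₚ-pair w z e≢g e∈w g∈w e∈z g∈z))
    via-y e∈w (inj₂ f∈w) = inj₁ (⊆ₚ-pair w x e≢f e∈w f∈w e∈x f∈x)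
    via-z : f ∈ₚ w → e ∈ₚ w ⊎ g ∈ₚ w → R
    via-z f∈w (inj₁ e∈w) = inj₁ (⊆ₚ-pair w x e≢f e∈w f∈w e∈x f∈x)
    via-z f∈w (inj₂ g∈w) = inj₂ (inj₁ (⊆ₚ-pair w y g≢f g∈w f∈w g∈y f∈y))
    via-x : e ∈ₚ w ⊎ f ∈ₚ w → R
    via-x (inj₁ e∈w) = via-y e∈w (meets-pair y g≢f g∈y f∈y yw)
    via-x (inj₂ f∈w) = via-z f∈w (meets-pair z e≢g e∈z g∈z zw)

  EdgeLt-asym : ∀ {e f : Edge G} → EdgeLt G e f → EdgeLt G f e → ⊥
  EdgeLt-asym (inj₁ e<f)        (inj₁ f<e)        = <-asym e<f f<e
  EdgeLt-asym (inj₁ e<f)        (inj₂ (f≡e , _))  = <-irrefl (cong toℕ (sym f≡e)) e<f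
  EdgeLt-asym (inj₂ (e≡f , _))  (inj₁ f<e)        = <-irrefl (cong toℕ (sym e≡f)) f<e
  EdgeLt-asym (inj₂ (_ , e<f))  (inj₂ (_ , f<e))  = <-asym e<f f<e

  -- Since each pair lists its edges in increasing order, equal edge sets mean equal edges.
  ⊆ₚ-same-edges : ∀ {t t′} w → t ⊆ₚ w → t′ ⊆ₚ w → e₁ t ≡ e₁ t′ × e₂ t ≡ e₂ t′
  ⊆ₚ-same-edges {t} {t′} w (e₁∈w , e₂∈w) (e₁′∈w , e₂′∈w) =
    match (in-t e₁′∈w) (in-t e₂′∈w)
    where
    in-t : ∀ {h} → h ∈ₚ w → h ≡ e₁ t ⊎ h ≡ e₂ t
    in-t = ∈ₚ-pair w (e₁≢e₂ t) e₁∈w e₂∈w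
    match : e₁ t′ ≡ e₁ t ⊎ e₁ t′ ≡ e₂ t → e₂ t′ ≡ e₁ t ⊎ e₂ t′ ≡ e₂ t →
            e₁ t ≡ e₁ t′ × e₂ t ≡ e₂ t′
    match (inj₁ p) (inj₂ q) = sym p , sym q
    match (inj₁ p) (inj₁ q) = ⊥-elim (e₁≢e₂ t′ (trans p (sym q)))
    match (inj₂ p) (inj₂ q) = ⊥-elim (e₁≢e₂ t′ (trans p (sym q)))
    match (inj₂ p) (inj₁ q) = ⊥-elim (EdgeLt-asym {e₁ t} {e₂ t} (lt t) (subst₂ (EdgeLt G) p q (lt t′)))

  ends : Edge G → Fin n × Fin n
  ends e = lo e , hi e

  data Shape (x : P2Sub G) (a b c : Fin n) : Set where
    centre-a : ends (e₁ x) ≡ (a , b) → ends (e₂ x) ≡ (a , c) → Shape x a b c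
    centre-b : ends (e₁ x) ≡ (a , b) → ends (e₂ x) ≡ (b , c) → Shape x a b c
    centre-c : ends (e₁ x) ≡ (a , c) → ends (e₂ x) ≡ (b , c) → Shape x a b c

  record Vertices (x : P2Sub G) : Set where
    field
      a b c : Fin n
      a<b   : toℕ a < toℕ b
      b<c   : toℕ b < toℕ c
      shape : Shape x a b c

  vertices : (x : P2Sub G) → Vertices x
  vertices x with share x | lt x
  ... | inj₁ lo≡lo | inj₁ lo<lo = ⊥-elim (<-irrefl (cong toℕ lo≡lo) lo<lo)
  ... | inj₁ lo≡lo | inj₂ (_ , hi<hi) =
    record { a<b = ordered (e₁ x) ; b<c = hi<hi ; shape = centre-a refl (cong (_, hi (e₂ x)) (sym lo≡lo)) }
  ... | inj₂ (inj₁ lo≡hi) | inj₁ lo<lo =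
    ⊥-elim (<-asym lo<lo (subst (λ v → toℕ (lo (e₂ x)) < toℕ v) (sym lo≡hi) (ordered (e₂ x))))
  ... | inj₂ (inj₁ lo≡hi) | inj₂ (lo≡lo , _) =
    ⊥-elim (<-irrefl (cong toℕ (trans (sym lo≡lo) lo≡hi)) (ordered (e₂ x)))
  ... | inj₂ (inj₂ (inj₁ hi≡lo)) | _ =
    record { a<b = ordered (e₁ x) ; b<c = subst (λ v → toℕ v < toℕ (hi (e₂ x))) (sym hi≡lo) (ordered (e₂ x))
           ; shape = centre-b refl (cong (_, hi (e₂ x)) (sym hi≡lo)) }
  ... | inj₂ (inj₂ (inj₂ hi≡hi)) | inj₁ lo<lo =
    record { a<b = lo<lo ; b<c = subst (λ v → toℕ (lo (e₂ x)) < toℕ v) (sym hi≡hi) (ordered (e₂ x))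
           ; shape = centre-c refl (cong (lo (e₂ x) ,_) (sym hi≡hi)) }
  ... | inj₂ (inj₂ (inj₂ hi≡hi)) | inj₂ (_ , hi<hi) = ⊥-elim (<-irrefl (cong toℕ hi≡hi) hi<hi)

  same-ends : ∀ e f {uv} → ends e ≡ uv → ends f ≡ uv → SameEdge G e f
  same-ends e f refl ef = cong proj₁ (sym ef) , cong proj₂ (sym ef)

  shapes-meet : ∀ {x y a b c} → Shape x a b c → Shape y a b c → ¬ DisjointP2 G x y
  shapes-meet {x} {y} (centre-a p _) (centre-a q _) (≢₁₁ , _) = ≢₁₁ (same-ends (e₁ x) (e₁ y) p q)
  shapes-meet {x} {y} (centre-a p _) (centre-b q _) (≢₁₁ , _) = ≢₁₁ (same-ends (e₁ x) (e₁ y) p q)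
  shapes-meet {x} {y} (centre-a _ p) (centre-c q _) (_ , _ , ≢₂₁ , _) = ≢₂₁ (same-ends (e₂ x) (e₁ y) p q)
  shapes-meet {x} {y} (centre-b p _) (centre-a q _) (≢₁₁ , _) = ≢₁₁ (same-ends (e₁ x) (e₁ y) p q)
  shapes-meet {x} {y} (centre-b p _) (centre-b q _) (≢₁₁ , _) = ≢₁₁ (same-ends (e₁ x) (e₁ y) p q)
  shapes-meet {x} {y} (centre-b _ p) (centre-c _ q) (_ , _ , _ , ≢₂₂) = ≢₂₂ (same-ends (e₂ x) (e₂ y) p q)
  shapes-meet {x} {y} (centre-c p _) (centre-a _ q) (_ , ≢₁₂ , _) = ≢₁₂ (same-ends (e₁ x) (e₂ y) p q)
  shapes-meet {x} {y} (centre-c _ p) (centre-b _ q) (_ , _ , _ , ≢₂₂) = ≢₂₂ (same-ends (e₂ x) (e₂ y) p q)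
  shapes-meet {x} {y} (centre-c p _) (centre-c q _) (≢₁₁ , _) = ≢₁₁ (same-ends (e₁ x) (e₁ y) p q)

-- Lower bound

module _ {n : ℕ} (G : SimpleGraph n) where

  edgeBetween : (u v : Fin n) → adj G u v ≡ true → Edge G
  edgeBetween u v uv with <-cmp (toℕ u) (toℕ v)
  ... | tri< u<v _ _ = mkEdge u v u<v uv
  ... | tri≈ _ u≡v _ = ⊥-elim (adj⇒≢ G uv (toℕ-injective u≡v))
  ... | tri> _ _ v<u = mkEdge v u v<u (trans (adj-sym G v u) uv)

  edgeBetween-ends : ∀ u v (uv : adj G u v ≡ true) →
    (lo (edgeBetween u v uv) ≡ u × hi (edgeBetween u v uv) ≡ v) ⊎
    (lo (edgeBetween u v uv) ≡ v × hi (edgeBetween u v uv) ≡ u)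
  edgeBetween-ends u v uv with <-cmp (toℕ u) (toℕ v)
  ... | tri< _ _ _   = inj₁ (refl , refl)
  ... | tri≈ _ u≡v _ = ⊥-elim (adj⇒≢ G uv (toℕ-injective u≡v))
  ... | tri> _ _ _   = inj₂ (refl , refl)

  private
    agree : ∀ {e e′ : Edge G} {x y} (end : Edge G → Fin n) →
            e ≡ e′ → end e ≡ x → end e′ ≡ y → x ≡ y
    agree end refl p q = trans (sym p) q

  edgeBetween-injective : ∀ {u v u′ v′} (uv : adj G u v ≡ true) (uv′ : adj G u′ v′ ≡ true) →
    edgeBetween u v uv ≡ edgeBetween u′ v′ uv′ → (u ≡ u′ × v ≡ v′) ⊎ (u ≡ v′ × v ≡ u′)
  edgeBetween-injective {u} {v} {u′} {v′} uv uv′ eq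
    with edgeBetween-ends u v uv | edgeBetween-ends u′ v′ uv′
  ... | inj₁ (l , h) | inj₁ (l′ , h′) = inj₁ (agree lo eq l l′ , agree hi eq h h′)
  ... | inj₁ (l , h) | inj₂ (l′ , h′) = inj₂ (agree lo eq l l′ , agree hi eq h h′)
  ... | inj₂ (l , h) | inj₁ (l′ , h′) = inj₂ (agree hi eq h h′ , agree lo eq l l′)
  ... | inj₂ (l , h) | inj₂ (l′ , h′) = inj₁ (agree hi eq h h′ , agree lo eq l l′)

  isCherryᵇ : Fin n → Fin n → Fin n → Bool
  isCherryᵇ v a b = (toℕ a <ᵇ toℕ b) ∧ adj G v a ∧ adj G v b

  cherry? : ∀ v a b → Dec (T (isCherryᵇ v a b))
  cherry? v a b = T? (isCherryᵇ v a b)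

  record IsCherry (v a b : Fin n) : Set where
    constructor cherry-at
    field
      leaves< : toℕ a < toℕ b
      adjˡ    : adj G v a ≡ true
      adjʳ    : adj G v b ≡ true

  isCherry : ∀ v a b → T (isCherryᵇ v a b) → IsCherry v a b
  isCherry v a b c with Equivalence.to (T-∧ {toℕ a <ᵇ toℕ b}) c
  ... | a<b , va∧vb with Equivalence.to (T-∧ {adj G v a}) va∧vb
  ...   | va , vb = cherry-at (<ᵇ⇒< _ _ a<b) (Equivalence.to T-≡ va) (Equivalence.to T-≡ vb)

  private
    cherry-lt : ∀ {v a b} → (c : IsCherry v a b) →
                EdgeLt G (edgeBetween v a (IsCherry.adjˡ c)) (edgeBetween v b (IsCherry.adjʳ c))
    cherry-lt {v} {a} {b} (cherry-at a<b va vb) with <-cmp (toℕ v) (toℕ a) | <-cmp (toℕ v) (toℕ b)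
    ... | tri≈ _ v≡a _ | _            = ⊥-elim (adj⇒≢ G va (toℕ-injective v≡a))
    ... | _            | tri≈ _ v≡b _ = ⊥-elim (adj⇒≢ G vb (toℕ-injective v≡b))
    ... | tri< _ _ _   | tri< _ _ _   = inj₂ (refl , a<b)
    ... | tri< v<a _ _ | tri> _ _ b<v = ⊥-elim (<-asym (<-trans v<a a<b) b<v)
    ... | tri> _ _ a<v | tri< _ _ _   = inj₁ a<v
    ... | tri> _ _ _   | tri> _ _ _   = inj₁ a<b

    cherry-share : ∀ {v a b} → (c : IsCherry v a b) →
                   ShareVertex G (edgeBetween v a (IsCherry.adjˡ c)) (edgeBetween v b (IsCherry.adjʳ c))
    cherry-share {v} {a} {b} (cherry-at _ va vb) with <-cmp (toℕ v) (toℕ a) | <-cmp (toℕ v) (toℕ b)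
    ... | tri≈ _ v≡a _ | _            = ⊥-elim (adj⇒≢ G va (toℕ-injective v≡a))
    ... | _            | tri≈ _ v≡b _ = ⊥-elim (adj⇒≢ G vb (toℕ-injective v≡b))
    ... | tri< _ _ _   | tri< _ _ _   = inj₁ refl
    ... | tri< _ _ _   | tri> _ _ _   = inj₂ (inj₁ refl)
    ... | tri> _ _ _   | tri< _ _ _   = inj₂ (inj₂ (inj₁ refl))
    ... | tri> _ _ _   | tri> _ _ _   = inj₂ (inj₂ (inj₂ refl))

  cherry : ∀ {v a b} → IsCherry v a b → P2Sub G
  cherry c@(cherry-at _ va vb) = mkP2 (edgeBetween _ _ va) (edgeBetween _ _ vb) (cherry-lt c) (cherry-share c)

  cherry-injective : ∀ {v a b v′ a′ b′} (c : IsCherry v a b) (c′ : IsCherry v′ a′ b′) →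
    e₁ (cherry c) ≡ e₁ (cherry c′) → e₂ (cherry c) ≡ e₂ (cherry c′) →
    v ≡ v′ × a ≡ a′ × b ≡ b′
  cherry-injective (cherry-at a<b va vb) (cherry-at a′<b′ va′ vb′) eq₁ eq₂
    with edgeBetween-injective va va′ eq₁ | edgeBetween-injective vb vb′ eq₂
  ... | inj₁ (v≡v′ , a≡a′) | inj₁ (_ , b≡b′)     = v≡v′ , a≡a′ , b≡b′
  ... | inj₁ (v≡v′ , _)    | inj₂ (_ , b≡v′)     = ⊥-elim (adj⇒≢ G vb (trans v≡v′ (sym b≡v′)))
  ... | inj₂ (v≡a′ , _)    | inj₁ (v≡v′ , _)     = ⊥-elim (adj⇒≢ G va′ (trans (sym v≡v′) v≡a′))
  ... | inj₂ (v≡a′ , _)    | inj₂ (v≡b′ , _)     = ⊥-elim (<⇒≢ᶠ a′<b′ (trans (sym v≡a′) v≡b′))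

  module _ {Q : P2Sub G → Set} (Q? : ∀ x → Dec (Q x)) where

    weight : ∀ v a b → Dec (T (isCherryᵇ v a b)) → ℕ
    weight v a b (yes c) = 𝟙 (Q? (cherry (isCherry v a b c)))
    weight v a b (no _)  = 0

    cherryCount : ℕ
    cherryCount = ∑[ v < n ] ∑[ a < n ] ∑[ b < n ] weight v a b (cherry? v a b)

    private
      weight-positive : ∀ v a b d → 0 < weight v a b d → Σ (IsCherry v a b) (Q ∘ cherry)
      weight-positive v a b (yes c) w>0 = isCherry v a b c , 𝟙-positive (Q? _) w>0
      weight-positive v a b (no _)  ()

      weight≤1 : ∀ v a b d → weight v a b d ≤ 1
      weight≤1 v a b (yes _) = 𝟙≤1 (Q? _)
      weight≤1 v a b (no _)  = z≤n

    cherryCount-none : (∀ x → ¬ Q x) → cherryCount ≡ 0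
    cherryCount-none ¬Q = ∑-zero {n} λ v → ∑-zero {n} λ a → ∑-zero {n} λ b → weight≡0 v a b (cherry? v a b)
      where
      weight≡0 : ∀ v a b d → weight v a b d ≡ 0
      weight≡0 v a b (yes c) = 𝟙-no (Q? _) (¬Q _)
      weight≡0 v a b (no _)  = refl

    cherryCount≤1 : (∀ {v a b v′ a′ b′} (c : IsCherry v a b) (c′ : IsCherry v′ a′ b′) →
                     Q (cherry c) → Q (cherry c′) → v ≡ v′ × a ≡ a′ × b ≡ b′) →
                    cherryCount ≤ 1
    cherryCount≤1 unique = ∑-≤1 (λ v → ∑[ a < n ] ∑[ b < n ] w v a b) row≤1 λ v v′ p p′ →
      let (_ , _ , c , q) = witness v p ; (_ , _ , c′ , q′) = witness v′ p′
      in proj₁ (unique c c′ q q′)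
      where
      w : Fin n → Fin n → Fin n → ℕ
      w v a b = weight v a b (cherry? v a b)
      witness₂ : ∀ v a → 0 < ∑[ b < n ] w v a b → ∃ λ b → Σ (IsCherry v a b) (Q ∘ cherry)
      witness₂ v a p with ∑-positive (w v a) p
      ... | b , wb>0 = b , weight-positive v a b (cherry? v a b) wb>0
      witness : ∀ v → 0 < ∑[ a < n ] ∑[ b < n ] w v a b →
                ∃ λ a → ∃ λ b → Σ (IsCherry v a b) (Q ∘ cherry)
      witness v p with ∑-positive (λ a → ∑[ b < n ] w v a b) p
      ... | a , wa>0 = a , witness₂ v a wa>0
      cell≤1 : ∀ v a → ∑[ b < n ] w v a b ≤ 1
      cell≤1 v a = ∑-≤1 (w v a) (λ b → weight≤1 v a b (cherry? v a b)) λ b b′ p p′ →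
        let (c , q)   = weight-positive v a b (cherry? v a b) p
            (c′ , q′) = weight-positive v a b′ (cherry? v a b′) p′
        in proj₂ (proj₂ (unique c c′ q q′))
      row≤1 : ∀ v → ∑[ a < n ] ∑[ b < n ] w v a b ≤ 1
      row≤1 v = ∑-≤1 (λ a → ∑[ b < n ] w v a b) (cell≤1 v) λ a a′ p p′ →
        let (_ , c , q) = witness₂ v a p ; (_ , c′ , q′) = witness₂ v a′ p′
        in proj₁ (proj₂ (unique c c′ q q′))

  cherryCount-⊎ : ∀ {Q R S : P2Sub G → Set}
                  (Q? : ∀ x → Dec (Q x)) (R? : ∀ x → Dec (R x)) (S? : ∀ x → Dec (S x)) →
                  (∀ x → Q x → R x ⊎ S x) → cherryCount Q? ≤ cherryCount R? + cherryCount S?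
  cherryCount-⊎ Q? R? S? Q⇒R⊎S = ≤-trans
    (∑-mono-≤ λ v → ∑-mono-≤ λ a → ∑-mono-≤ λ b → cell v a b (cherry? v a b))
    (≤-reflexive (trans (sum-cong-≗ {n} λ v → trans (sum-cong-≗ {n} λ a → ∑-distrib-+ {n} _ _)
                                                   (∑-distrib-+ {n} _ _))
                        (∑-distrib-+ {n} _ _)))
    where
    cell : ∀ v a b d → weight Q? v a b d ≤ weight R? v a b d + weight S? v a b d
    cell v a b (yes c) = 𝟙-⊎ (Q? _) (R? _) (S? _) (Q⇒R⊎S _)
    cell v a b (no _)  = z≤n

  ∑-cherryCount-colors : ∀ {m} (c : P2Sub G → Fin m) →
                          ∑[ k < m ] cherryCount (λ x → c x ≟ᶠ k) ≡ ∑[ v < n ] pairCount (adj G v)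
  ∑-cherryCount-colors {m} c = begin
      ∑[ k < m ] ∑[ v < n ] ∑[ a < n ] ∑[ b < n ] w k v a b
    ≡⟨ ∑-comm {m} {n} _ ⟩
      ∑[ v < n ] ∑[ k < m ] ∑[ a < n ] ∑[ b < n ] w k v a b
    ≡⟨ sum-cong-≗ {n} (λ v → ∑-comm {m} {n} _) ⟩
      ∑[ v < n ] ∑[ a < n ] ∑[ k < m ] ∑[ b < n ] w k v a b
    ≡⟨ sum-cong-≗ {n} (λ v → sum-cong-≗ {n} λ a → ∑-comm {m} {n} _) ⟩
      ∑[ v < n ] ∑[ a < n ] ∑[ b < n ] ∑[ k < m ] w k v a b
    ≡⟨ sum-cong-≗ {n} (λ v → sum-cong-≗ {n} λ a → sum-cong-≗ {n} λ b →
                        one-color v a b (cherry? v a b)) ⟩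
      ∑[ v < n ] pairCount (adj G v) ∎
    where
    open ≡-Reasoning
    w : Fin m → Fin n → Fin n → Fin n → ℕ
    w k v a b = weight (λ x → c x ≟ᶠ k) v a b (cherry? v a b)
    one-color : ∀ v a b d → ∑[ k < m ] weight (λ x → c x ≟ᶠ k) v a b d ≡ 𝟙 d
    one-color v a b (yes ch) = ∑-𝟙-≟ˡ m (c (cherry (isCherry v a b ch)))
    one-color v a b (no _)   = ∑-zero {m} λ _ → refl

  cherryCount-⊆ₚ≤1 : ∀ w → cherryCount (λ t → t ⊆ₚ? w) ≤ 1
  cherryCount-⊆ₚ≤1 w = cherryCount≤1 (λ t → t ⊆ₚ? w) λ ch ch′ ch⊆w ch′⊆w →
    let (e₁≡ , e₂≡) = ⊆ₚ-same-edges {t = cherry ch} {cherry ch′} w ch⊆w ch′⊆w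
    in cherry-injective ch ch′ e₁≡ e₂≡

module _ {n m : ℕ} (G : SimpleGraph n) (c : P2Sub G → Fin m)
         (proper : ∀ x y → DisjointP2 G x y → c x ≢ c y) where

  sameColor⇒meets : ∀ {x y} → c x ≡ c y → Meets x y
  sameColor⇒meets {x} {y} cx≡cy = ¬disjoint⇒meets x y λ disj → proper x y disj cx≡cy

  HasStarClass : Set
  HasStarClass = Σ (Fin m) λ k → Σ (Edge G) λ e → ∀ x → c x ≡ k → e ∈ₚ x

  -- An intersecting family of copies of P₂ with no common edge lies inside a triangle.
  cherryCount-class≤3 : ¬ HasStarClass → ∀ k → cherryCount G (λ x → c x ≟ᶠ k) ≤ 3
  cherryCount-class≤3 noStar k = decidable-stable (_ ≤? 3) λ ¬≤3 → ¬¬-excluded-middle λ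
    { (no empty) → ¬≤3 (subst (_≤ 3) (sym (cherryCount-none G _ λ x cx → empty (x , cx))) z≤n)
    ; (yes (x , cx)) → avoiding (e₁ x) λ (y , cy , e∉y) → avoiding (e₂ x) λ (z , cz , f∉z) →
        ¬≤3 (bound x y z cx cy cz e∉y f∉z) }
    where
    avoiding : ∀ e → ¬ ¬ (∃ λ y → c y ≡ k × ¬ e ∈ₚ y)
    avoiding e ¬avoid =
      noStar (k , e , λ y cy → decidable-stable (e ∈ₚ? y) λ e∉y → ¬avoid (y , cy , e∉y))
    bound : ∀ x y z → c x ≡ k → c y ≡ k → c z ≡ k → ¬ e₁ x ∈ₚ y → ¬ e₂ x ∈ₚ z →
            cherryCount G (λ w → c w ≟ᶠ k) ≤ 3
    bound x y z cx cy cz e∉y f∉z = begin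
        cherryCount G (λ w → c w ≟ᶠ k)
      ≤⟨ cherryCount-⊎ G _ (_⊆ₚ? x) (λ w → (w ⊆ₚ? y) ⊎-dec (w ⊆ₚ? z)) in-triangle ⟩
        #⊆ x + cherryCount G (λ w → (w ⊆ₚ? y) ⊎-dec (w ⊆ₚ? z))
      ≤⟨ +-monoʳ-≤ (#⊆ x) (cherryCount-⊎ G _ (_⊆ₚ? y) (_⊆ₚ? z) λ _ → id) ⟩
        #⊆ x + (#⊆ y + #⊆ z)
      ≤⟨ +-mono-≤ (cherryCount-⊆ₚ≤1 G x) (+-mono-≤ (cherryCount-⊆ₚ≤1 G y) (cherryCount-⊆ₚ≤1 G z)) ⟩
        3 ∎
      where
      open ≤-Reasoning
      #⊆ : P2Sub G → ℕ
      #⊆ v = cherryCount G (_⊆ₚ? v)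
      same : ∀ {u v} → c u ≡ k → c v ≡ k → Meets u v
      same cu cv = sameColor⇒meets (trans cu (sym cv))
      in-triangle : ∀ w → c w ≡ k → w ⊆ₚ x ⊎ w ⊆ₚ y ⊎ w ⊆ₚ z
      in-triangle w cw =
        triangle (same cx cy) (same cx cz) (same cy cz) (same cx cw) (same cy cw) (same cz cw) e∉y f∉z

  -- Each vertex of degree d is the centre of d(d-1)/2 ≥ (3d - 4)/2 cherries, and without a
  -- star class each of the m colors holds at most 3 of them.
  3*edgeCount≤3*m+2*n-without-star : ¬ HasStarClass → 3 * edgeCount G ≤ 3 * m + 2 * n
  3*edgeCount≤3*m+2*n-without-star noStar = *-cancelˡ-≤ 2 (begin
      2 * (3 * edgeCount G)
    ≡⟨ solve 1 (λ e → con 2 :* (con 3 :* e) := con 3 :* (con 2 :* e)) refl (edgeCount G) ⟩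
      3 * (2 * edgeCount G)
    ≡⟨ cong (3 *_) (sym (handshake G)) ⟩
      3 * ∑[ v < n ] degree G v
    ≡⟨ *-distribˡ-sum 3 (degree G) ⟩
      ∑[ v < n ] (3 * degree G v)
    ≤⟨ ∑-mono-≤ (λ v → 3*count≤2*pairCount+4 (adj G v)) ⟩
      ∑[ v < n ] (2 * pairCount (adj G v) + 4)
    ≡⟨ ∑-distrib-+ {n} _ _ ⟩
      ∑[ v < n ] (2 * pairCount (adj G v)) + ∑[ v < n ] 4
    ≡⟨ cong₂ _+_ (sym (*-distribˡ-sum 2 λ v → pairCount (adj G v))) (∑-const n 4) ⟩
      2 * ∑[ v < n ] pairCount (adj G v) + n * 4
    ≡⟨ cong (λ t → 2 * t + n * 4) (sym (∑-cherryCount-colors G c)) ⟩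
      2 * ∑[ k < m ] cherryCount G (λ x → c x ≟ᶠ k) + n * 4
    ≤⟨ +-monoˡ-≤ (n * 4) (*-monoʳ-≤ 2 (∑-mono-≤ (cherryCount-class≤3 noStar))) ⟩
      2 * ∑[ k < m ] 3 + n * 4
    ≡⟨ cong (λ t → 2 * t + n * 4) (∑-const m 3) ⟩
      2 * (m * 3) + n * 4
    ≡⟨ solve 2 (λ m n → con 2 :* (m :* con 3) :+ n :* con 4 := con 2 :* (con 3 :* m :+ con 2 :* n)) refl m n ⟩
      2 * (3 * m + 2 * n) ∎)
    where open ≤-Reasoning

module _ {n : ℕ} (G : SimpleGraph n) (e : Edge G) where

  private
    IsE : Fin n → Fin n → Set
    IsE u w = (u ≡ lo e × w ≡ hi e) ⊎ (u ≡ hi e × w ≡ lo e)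

    isE? : ∀ u w → Dec (IsE u w)
    isE? u w = ((u ≟ᶠ lo e) ×-dec (w ≟ᶠ hi e)) ⊎-dec ((u ≟ᶠ hi e) ×-dec (w ≟ᶠ lo e))

    isE-sym : ∀ u w → does (isE? u w) ≡ does (isE? w u)
    isE-sym u w = does-cong (isE? u w) (isE? w u) flip flip
      where
      flip : ∀ {u w} → IsE u w → IsE w u
      flip (inj₁ (p , q)) = inj₂ (q , p)
      flip (inj₂ (p , q)) = inj₁ (q , p)

  deleteEdge : SimpleGraph n
  deleteEdge = record
    { adj    = λ u w → adj G u w ∧ not (does (isE? u w))
    ; sym    = λ u w → cong₂ (λ a b → a ∧ not b) (adj-sym G u w) (isE-sym u w)
    ; irrefl = λ u → cong (_∧ not (does (isE? u u))) (irrefl G u)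
    }

  private
    isLoHi? : ∀ u w → Dec (u ≡ lo e × w ≡ hi e)
    isLoHi? u w = (u ≟ᶠ lo e) ×-dec (w ≟ᶠ hi e)

    lo≢hi : lo e ≢ hi e
    lo≢hi lo≡hi = <-irrefl (cong toℕ lo≡hi) (ordered e)

    isEdge-split : ∀ u w (d : Dec (IsE u w)) →
                   𝟙 (T? ((toℕ u <ᵇ toℕ w) ∧ adj G u w)) ≡
                   𝟙 (T? ((toℕ u <ᵇ toℕ w) ∧ adj G u w ∧ not (does d))) + 𝟙 (isLoHi? u w)
    isEdge-split u w (no ¬E) rewrite ∧-identityʳ (adj G u w) | 𝟙-no (isLoHi? u w) (¬E ∘ inj₁) =
      sym (+-identityʳ _)
    isEdge-split u w (yes (inj₁ (refl , refl))) rewrite <⇒<ᵇ≡true (ordered e) | isEdge e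
      | 𝟙-yes ((lo e ≟ᶠ lo e) ×-dec (hi e ≟ᶠ hi e)) (refl , refl) = refl
    isEdge-split u w (yes (inj₂ (refl , refl))) rewrite ≮⇒<ᵇ≡false (<-asym (ordered e))
      | 𝟙-no ((hi e ≟ᶠ lo e) ×-dec (lo e ≟ᶠ hi e)) (lo≢hi ∘ sym ∘ proj₁) = refl

  edgeCount-deleteEdge : edgeCount G ≡ suc (edgeCount deleteEdge)
  edgeCount-deleteEdge = begin
      edgeCount G
    ≡⟨ edgeCount≡∑∑ G ⟩
      ∑[ u < n ] ∑[ w < n ] 𝟙 (T? (isEdgeᵇ G u w))
    ≡⟨ sum-cong-≗ {n} (λ u → trans (sum-cong-≗ {n} λ w → isEdge-split u w (isE? u w)) (∑-distrib-+ {n} _ _)) ⟩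
      ∑[ u < n ] (∑[ w < n ] 𝟙 (T? (isEdgeᵇ deleteEdge u w)) + ∑[ w < n ] 𝟙 (isLoHi? u w))
    ≡⟨ ∑-distrib-+ {n} _ _ ⟩
      ∑[ u < n ] ∑[ w < n ] 𝟙 (T? (isEdgeᵇ deleteEdge u w)) + ∑[ u < n ] ∑[ w < n ] 𝟙 (isLoHi? u w)
    ≡⟨ cong₂ _+_ (sym (edgeCount≡∑∑ deleteEdge)) (∑∑-𝟙-≟ (lo e) (hi e)) ⟩
      edgeCount deleteEdge + 1
    ≡⟨ +-comm _ 1 ⟩
      suc (edgeCount deleteEdge) ∎
    where open ≡-Reasoning

  private
    liftEdge : Edge deleteEdge → Edge G
    liftEdge f = mkEdge (lo f) (hi f) (ordered f) (∧-conicalˡ _ _ (isEdge f))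

    ≡liftEdge⇒isE : ∀ f → e ≡ liftEdge f → does (isE? (lo f) (hi f)) ≡ true
    ≡liftEdge⇒isE f e≡f = dec-true (isE? (lo f) (hi f)) (inj₁ (sym (cong lo e≡f) , sym (cong hi e≡f)))

    ≢liftEdge : ∀ f → e ≢ liftEdge f
    ≢liftEdge f e≡f with subst (λ b → not b ≡ true) (≡liftEdge⇒isE f e≡f) (∧-conicalʳ _ _ (isEdge f))
    ... | ()

  liftP2 : P2Sub deleteEdge → P2Sub G
  liftP2 x = mkP2 (liftEdge (e₁ x)) (liftEdge (e₂ x)) (lt x) (share x)

  ∉liftP2 : ∀ x → ¬ e ∈ₚ liftP2 x
  ∉liftP2 x (inj₁ e≡e₁) = ≢liftEdge (e₁ x) e≡e₁
  ∉liftP2 x (inj₂ e≡e₂) = ≢liftEdge (e₂ x) e≡e₂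

-- Deleting the common edge of a star class leaves a graph whose copies of P₂ avoid that color,
-- so induction on the number of colors reduces to the star-free case. Whether a star class
-- exists is not decidable here, so the case split is made under ¬¬ against a decidable goal.
3*edgeCount≤3*m+2*n : ∀ m {n} (G : SimpleGraph n) → Colorable (P2Sub G) (DisjointP2 G) m →
                      3 * edgeCount G ≤ 3 * m + 2 * n
3*edgeCount≤3*m+2*n zero    G (c , proper) = 3*edgeCount≤3*m+2*n-without-star G c proper λ { (() , _) }
3*edgeCount≤3*m+2*n (suc m) {n} G (c , proper) = decidable-stable (_ ≤? _) λ ¬bound → ¬¬-excluded-middle λ
  { (no noStar)         → ¬bound (3*edgeCount≤3*m+2*n-without-star G c proper noStar)
  ; (yes (k , e , star)) → ¬bound (with-star k e star) }
  where
  with-star : ∀ k e → (∀ x → c x ≡ k → e ∈ₚ x) → 3 * edgeCount G ≤ 3 * suc m + 2 * n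
  with-star k e star = begin
      3 * edgeCount G
    ≡⟨ trans (cong (3 *_) (edgeCount-deleteEdge G e)) (*-suc 3 _) ⟩
      3 + 3 * edgeCount (deleteEdge G e)
    ≤⟨ +-monoʳ-≤ 3 (3*edgeCount≤3*m+2*n m (deleteEdge G e) (c′ , proper′)) ⟩
      3 + (3 * m + 2 * n)
    ≡⟨ solve 2 (λ m n → con 3 :+ (con 3 :* m :+ con 2 :* n) := con 3 :* (con 1 :+ m) :+ con 2 :* n) refl m n ⟩
      3 * suc m + 2 * n ∎
    where
    open ≤-Reasoning
    k≢ : ∀ x → k ≢ c (liftP2 G e x)
    k≢ x k≡ = ∉liftP2 G e x (star (liftP2 G e x) (sym k≡))
    c′ : P2Sub (deleteEdge G e) → Fin m
    c′ x = punchOut (k≢ x)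
    proper′ : ∀ x y → DisjointP2 (deleteEdge G e) x y → c′ x ≢ c′ y
    proper′ x y disj c′≡ = proper (liftP2 G e x) (liftP2 G e y) disj (punchOut-injective (k≢ x) (k≢ y) c′≡)

-- Upper bound

least : ∀ {n} {P : Fin n → Set} → (∀ i → Dec (P i)) → ∃ P →
        ∃ λ i → P i × (∀ j → P j → toℕ i ≤ toℕ j)
least {suc n} {P} P? ∃P with P? fz
... | yes P0 = fz , P0 , λ _ _ → z≤n
... | no ¬P0 = shift ∃P
  where
  shift : ∃ P → ∃ λ i → P i × (∀ j → P j → toℕ i ≤ toℕ j)
  shift (fz , P0) = ⊥-elim (¬P0 P0)
  shift (fs i , Pi) with least (P? ∘ fs) (i , Pi)
  ... | k , Pk , k≤ = fs k , Pk , above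
    where
    above : ∀ j → P j → toℕ (fs k) ≤ toℕ j
    above fz     Pj = ⊥-elim (¬P0 Pj)
    above (fs j) Pj = s≤s (k≤ j Pj)

classSize≥4 : ∀ {n q} (comp : Fin n → Fin q) {a b c d : Fin n} →
              a ≢ b → a ≢ c → a ≢ d → b ≢ c → b ≢ d → c ≢ d →
              comp b ≡ comp a → comp c ≡ comp a → comp d ≡ comp a → 4 ≤ classSize comp (comp a)
classSize≥4 {n} comp {a} {b} {c} {d} a≢b a≢c a≢d b≢c b≢d c≢d b~a c~a d~a = begin
    4
  ≡⟨ cong₂ _+_ (cong₂ _+_ (cong₂ _+_ (∑-𝟙-≟ n a) (∑-𝟙-≟ n b)) (∑-𝟙-≟ n c)) (∑-𝟙-≟ n d) ⟨
    ∑[ v < n ] 𝟙 (v ≟ᶠ a) + ∑[ v < n ] 𝟙 (v ≟ᶠ b)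
      + ∑[ v < n ] 𝟙 (v ≟ᶠ c) + ∑[ v < n ] 𝟙 (v ≟ᶠ d)
  ≡⟨ trans (∑-distrib-+ {n} _ _)
           (cong (_+ _) (trans (∑-distrib-+ {n} _ _) (cong (_+ _) (∑-distrib-+ {n} _ _)))) ⟨
    ∑[ v < n ] (𝟙 (v ≟ᶠ a) + 𝟙 (v ≟ᶠ b) + 𝟙 (v ≟ᶠ c) + 𝟙 (v ≟ᶠ d))
  ≤⟨ ∑-mono-≤ at-most-member ⟩
    ∑[ v < n ] 𝟙 (comp v ≟ᶠ comp a)
  ≡⟨ length-filter-tabulate (λ v → comp v ≟ᶠ comp a) id ⟨
    classSize comp (comp a) ∎
  where
  open ≤-Reasoning
  at-most-member : ∀ v → 𝟙 (v ≟ᶠ a) + 𝟙 (v ≟ᶠ b) + 𝟙 (v ≟ᶠ c) + 𝟙 (v ≟ᶠ d) ≤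
                         𝟙 (comp v ≟ᶠ comp a)
  at-most-member v with v ≟ᶠ a
  ... | yes refl rewrite 𝟙-no (v ≟ᶠ b) a≢b | 𝟙-no (v ≟ᶠ c) a≢c | 𝟙-no (v ≟ᶠ d) a≢d
                       | 𝟙-yes (comp v ≟ᶠ comp v) refl = ≤-refl
  ... | no _ with v ≟ᶠ b
  ...   | yes refl rewrite 𝟙-no (v ≟ᶠ c) b≢c | 𝟙-no (v ≟ᶠ d) b≢d
                         | 𝟙-yes (comp v ≟ᶠ comp a) b~a = ≤-refl
  ...   | no _ with v ≟ᶠ c
  ...     | yes refl rewrite 𝟙-no (v ≟ᶠ d) c≢d | 𝟙-yes (comp v ≟ᶠ comp a) c~a = ≤-refl
  ...     | no _ with v ≟ᶠ d
  ...       | yes refl rewrite 𝟙-yes (comp v ≟ᶠ comp a) d~a = ≤-refl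
  ...       | no _ = z≤n

module _ {n q : ℕ} (comp : Fin n → Fin q) where

  Between : Fin n → Fin n → Set
  Between u w = ∃ λ z → comp z ≡ comp u × toℕ u < toℕ z × toℕ z < toℕ w

  Free : Fin n → Fin n → Set
  Free u w = toℕ u < toℕ w × comp u ≡ comp w × ¬ Between u w

  free? : ∀ u w → Dec (Free u w)
  free? u w = (toℕ u <? toℕ w) ×-dec (comp u ≟ᶠ comp w) ×-dec
              ¬? (any? λ z → (comp z ≟ᶠ comp u) ×-dec (toℕ u <? toℕ z) ×-dec (toℕ z <? toℕ w))

  freeCount : ℕ
  freeCount = ∑[ u < n ] ∑[ w < n ] 𝟙 (free? u w)

  private
    HasUp : Fin n → Set
    HasUp u = ∃ λ w → comp w ≡ comp u × toℕ u < toℕ w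

    hasUp? : ∀ u → Dec (HasUp u)
    hasUp? u = any? λ w → (comp w ≟ᶠ comp u) ×-dec (toℕ u <? toℕ w)

    -- the least classmate above u is joined to u by a free edge
    hasUp⇒free : ∀ u → 𝟙 (hasUp? u) ≤ ∑[ w < n ] 𝟙 (free? u w)
    hasUp⇒free u with hasUp? u
    ... | no _ = z≤n
    ... | yes up with least (λ w → (comp w ≟ᶠ comp u) ×-dec (toℕ u <? toℕ w)) up
    ...   | w , (cw , u<w) , minimal = ≤-trans (≤-reflexive (sym (𝟙-yes (free? u w) free)))
                                              (term≤∑ (λ w → 𝟙 (free? u w)) w)
      where
      free : Free u w
      free = u<w , sym cw , λ (z , cz , u<z , z<w) → <-irrefl refl (<-≤-trans z<w (minimal z (cz , u<z)))

    -- each class has at most one member with nothing above it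
    tops≤q : ∑[ u < n ] 𝟙 (¬? (hasUp? u)) ≤ q
    tops≤q = begin
        ∑[ u < n ] 𝟙 (¬? (hasUp? u))
      ≡⟨ sum-cong-≗ {n} (λ u → sym (∑-𝟙-top u)) ⟩
        ∑[ u < n ] ∑[ i < q ] 𝟙 (top? i u)
      ≡⟨ ∑-comm {n} {q} _ ⟩
        ∑[ i < q ] ∑[ u < n ] 𝟙 (top? i u)
      ≤⟨ ∑-mono-≤ (λ i → ∑-≤1 (λ u → 𝟙 (top? i u)) (λ u → 𝟙≤1 (top? i u)) (unique-top i)) ⟩
        ∑[ i < q ] 1
      ≡⟨ trans (∑-const q 1) (*-identityʳ q) ⟩
        q ∎
      where
      open ≤-Reasoning
      top? : ∀ i u → Dec (¬ HasUp u × comp u ≡ i)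
      top? i u = ¬? (hasUp? u) ×-dec (comp u ≟ᶠ i)
      ∑-𝟙-top : ∀ u → ∑[ i < q ] 𝟙 (¬? (hasUp? u) ×-dec (comp u ≟ᶠ i)) ≡ 𝟙 (¬? (hasUp? u))
      ∑-𝟙-top u with hasUp? u
      ... | yes _ = ∑-zero {q} λ _ → refl
      ... | no _  = ∑-𝟙-≟ˡ q (comp u)
      unique-top : ∀ i u u′ → 0 < 𝟙 (top? i u) → 0 < 𝟙 (top? i u′) → u ≡ u′
      unique-top i u u′ p p′ with 𝟙-positive (top? i u) p | 𝟙-positive (top? i u′) p′
      ... | ¬up , cu | ¬up′ , cu′ with <-cmp (toℕ u) (toℕ u′)
      ...   | tri< u<u′ _ _ = ⊥-elim (¬up (u′ , trans cu′ (sym cu) , u<u′))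
      ...   | tri≈ _ u≡u′ _ = toℕ-injective u≡u′
      ...   | tri> _ _ u′<u = ⊥-elim (¬up′ (u , trans cu (sym cu′) , u′<u))

  n≤freeCount+q : n ≤ freeCount + q
  n≤freeCount+q = begin
      n
    ≡⟨ sym (trans (∑-const n 1) (*-identityʳ n)) ⟩
      ∑[ u < n ] 1
    ≡⟨ sum-cong-≗ {n} (λ u → sym (𝟙-+-𝟙-¬ (hasUp? u))) ⟩
      ∑[ u < n ] (𝟙 (hasUp? u) + 𝟙 (¬? (hasUp? u)))
    ≡⟨ ∑-distrib-+ {n} _ _ ⟩
      ∑[ u < n ] 𝟙 (hasUp? u) + ∑[ u < n ] 𝟙 (¬? (hasUp? u))
    ≤⟨ +-mono-≤ (∑-mono-≤ hasUp⇒free) tops≤q ⟩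
      freeCount + q ∎
    where open ≤-Reasoning

module _ {n q : ℕ} (G : SimpleGraph n) (comp : Fin n → Fin q)
         (clique : ∀ u v → u ≢ v → comp u ≡ comp v → adj G u v ≡ true) where

  NonFree : Fin n × Fin n → Set
  NonFree (u , w) = T (isEdgeᵇ G u w) × ¬ Free comp u w

  nonFree? : ∀ uw → Dec (NonFree uw)
  nonFree? (u , w) = T? (isEdgeᵇ G u w) ×-dec ¬? (free? comp u w)

  nonFreeEdges : List (Fin n × Fin n)
  nonFreeEdges = filter nonFree? (cartesianProduct (allFin n) (allFin n))

  nonFree∈ : ∀ {uw} → NonFree uw → uw ∈ nonFreeEdges
  nonFree∈ {u , w} = ∈-filter⁺ nonFree? (∈-cartesianProduct⁺ (∈-allFin u) (∈-allFin w))

  <-classmates⇒edge : ∀ {u w} → toℕ u < toℕ w → comp u ≡ comp w → T (isEdgeᵇ G u w)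
  <-classmates⇒edge {u} {w} u<w same = Equivalence.from T-∧
    (<⇒<ᵇ u<w , Equivalence.from T-≡ (clique u w (λ u≡w → <-irrefl (cong toℕ u≡w) u<w) same))

  edgeCount≡nonFree+free : edgeCount G ≡ length nonFreeEdges + freeCount comp
  edgeCount≡nonFree+free = begin
      edgeCount G
    ≡⟨ edgeCount≡∑∑ G ⟩
      ∑[ u < n ] ∑[ w < n ] 𝟙 (T? (isEdgeᵇ G u w))
    ≡⟨ sum-cong-≗ {n} (λ u → trans (sum-cong-≗ {n} (split u)) (∑-distrib-+ {n} _ _)) ⟩
      ∑[ u < n ] (∑[ w < n ] 𝟙 (nonFree? (u , w)) + ∑[ w < n ] 𝟙 (free? comp u w))
    ≡⟨ ∑-distrib-+ {n} _ _ ⟩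
      ∑[ u < n ] ∑[ w < n ] 𝟙 (nonFree? (u , w)) + freeCount comp
    ≡⟨ cong (_+ freeCount comp) (sym (length-filter-cartesianProduct nonFree?)) ⟩
      length nonFreeEdges + freeCount comp ∎
    where
    open ≡-Reasoning
    split : ∀ u w → 𝟙 (T? (isEdgeᵇ G u w)) ≡ 𝟙 (nonFree? (u , w)) + 𝟙 (free? comp u w)
    split u w = 𝟙-split (T? (isEdgeᵇ G u w)) (free? comp u w) λ (u<w , same , _) → <-classmates⇒edge u<w same

  module _ (small : ∀ i → classSize comp i ≤ 3) where

    private
      Inside : Edge G → Set
      Inside e = comp (lo e) ≡ comp (hi e)

      inside-ends : ∀ e {u v} → ends e ≡ (u , v) → Inside e → comp u ≡ comp v
      inside-ends e refl inside = inside

      shape-classmates : ∀ {x a b c} → Shape x a b c → Inside (e₁ x) → Inside (e₂ x) →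
                         comp b ≡ comp a × comp c ≡ comp a
      shape-classmates {x} (centre-a p q) i₁ i₂ =
        sym (inside-ends (e₁ x) p i₁) , sym (inside-ends (e₂ x) q i₂)
      shape-classmates {x} (centre-b p q) i₁ i₂ =
        sym (inside-ends (e₁ x) p i₁) , sym (trans (inside-ends (e₁ x) p i₁) (inside-ends (e₂ x) q i₂))
      shape-classmates {x} (centre-c p q) i₁ i₂ =
        trans (inside-ends (e₂ x) q i₂) (sym (inside-ends (e₁ x) p i₁)) , sym (inside-ends (e₁ x) p i₁)

    data Route (x : P2Sub G) : Set where
      via-e₁   : ¬ Inside (e₁ x) → Route x
      via-e₂   : ¬ Inside (e₂ x) → Route x
      via-hull : Inside (e₁ x) → Inside (e₂ x) → Route x

    route : ∀ x → Route x
    route x with comp (lo (e₁ x)) ≟ᶠ comp (hi (e₁ x)) | comp (lo (e₂ x)) ≟ᶠ comp (hi (e₂ x))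
    ... | no out₁ | _       = via-e₁ out₁
    ... | yes _   | no out₂ = via-e₂ out₂
    ... | yes in₁ | yes in₂ = via-hull in₁ in₂

    -- A copy of P₂ with an edge leaving its class is colored by that edge; one inside a
    -- class a < b < c (a triangle, since classes have at most three vertices) by the edge ac.
    colorEdge : (x : P2Sub G) → Route x → Fin n × Fin n
    colorEdge x (via-e₁ _)   = ends (e₁ x)
    colorEdge x (via-e₂ _)   = ends (e₂ x)
    colorEdge x (via-hull _ _) = Vertices.a (vertices x) , Vertices.c (vertices x)

    colorEdge-nonFree : ∀ x r → NonFree (colorEdge x r)
    colorEdge-nonFree x (via-e₁ out) = edge⇒isEdgeᵇ G (e₁ x) , out ∘ proj₁ ∘ proj₂
    colorEdge-nonFree x (via-e₂ out) = edge⇒isEdgeᵇ G (e₂ x) , out ∘ proj₁ ∘ proj₂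
    colorEdge-nonFree x (via-hull in₁ in₂) =
      <-classmates⇒edge a<c (sym (proj₂ classmates)) ,
      λ (_ , _ , nothing-between) → nothing-between (b , proj₁ classmates , a<b , b<c)
      where
      open Vertices (vertices x)
      a<c : toℕ a < toℕ c
      a<c = <-trans a<b b<c
      classmates : comp b ≡ comp a × comp c ≡ comp a
      classmates = shape-classmates shape in₁ in₂

    colorEdge∈ : ∀ x → colorEdge x (route x) ∈ nonFreeEdges
    colorEdge∈ x = nonFree∈ (colorEdge-nonFree x (route x))

    color : P2Sub G → Fin (length nonFreeEdges)
    color x = index (colorEdge∈ x)

    private
      inside-from : ∀ e {u v} → ends e ≡ (u , v) → comp u ≡ comp v → Inside e
      inside-from e refl uv = uv

      -- Copies of P₂ inside classes with the same hull a, c lie in one triangle: the class of a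
      -- cannot hold the four vertices a, b, b′, c.
      same-hull : ∀ {x y a b c a′ b′ c′} → Shape x a b c → Shape y a′ b′ c′ →
                  toℕ a < toℕ b → toℕ b < toℕ c → toℕ a′ < toℕ b′ → toℕ b′ < toℕ c′ →
                  comp b ≡ comp a × comp c ≡ comp a → comp b′ ≡ comp a′ × comp c′ ≡ comp a′ →
                  a ≡ a′ → c ≡ c′ → ¬ DisjointP2 G x y
      same-hull {b = b} {b′ = b′} sx sy a<b b<c a<b′ b′<c (b~a , c~a) (b′~a , _) refl refl with b ≟ᶠ b′
      ... | yes refl = shapes-meet sx sy
      ... | no b≢b′  = ⊥-elim (<-irrefl refl (≤-trans four (small _)))
        where
        four : 4 ≤ classSize comp (comp _)
        four = classSize≥4 comp (<⇒≢ᶠ a<b) (<⇒≢ᶠ (<-trans a<b b<c)) (<⇒≢ᶠ a<b′) (<⇒≢ᶠ b<c) b≢b′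
                           (≢-sym (<⇒≢ᶠ b′<c)) b~a c~a b′~a

    color-proper : ∀ x y → DisjointP2 G x y → color x ≢ color y
    color-proper x y disj@(≢₁₁ , ≢₁₂ , ≢₂₁ , ≢₂₂) same = clash (route x) (route y)
      (index-injective (setoid _) (colorEdge∈ x) (colorEdge∈ y) same)
      where
      open Vertices (vertices x)
      module Y = Vertices (vertices y)
      clash : (r : Route x) (s : Route y) → colorEdge x r ≡ colorEdge y s → ⊥
      clash (via-e₁ _) (via-e₁ _) eq = ≢₁₁ (same-ends (e₁ x) (e₁ y) eq refl)
      clash (via-e₁ _) (via-e₂ _) eq = ≢₁₂ (same-ends (e₁ x) (e₂ y) eq refl)
      clash (via-e₂ _) (via-e₁ _) eq = ≢₂₁ (same-ends (e₂ x) (e₁ y) eq refl)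
      clash (via-e₂ _) (via-e₂ _) eq = ≢₂₂ (same-ends (e₂ x) (e₂ y) eq refl)
      clash (via-e₁ out) (via-hull in₁ in₂) eq =
        out (inside-from (e₁ x) eq (sym (proj₂ (shape-classmates Y.shape in₁ in₂))))
      clash (via-e₂ out) (via-hull in₁ in₂) eq =
        out (inside-from (e₂ x) eq (sym (proj₂ (shape-classmates Y.shape in₁ in₂))))
      clash (via-hull in₁ in₂) (via-e₁ out) eq =
        out (inside-from (e₁ y) (sym eq) (sym (proj₂ (shape-classmates shape in₁ in₂))))
      clash (via-hull in₁ in₂) (via-e₂ out) eq =
        out (inside-from (e₂ y) (sym eq) (sym (proj₂ (shape-classmates shape in₁ in₂))))
      clash (via-hull in₁ in₂) (via-hull in₁′ in₂′) eq =
        same-hull shape Y.shape a<b b<c Y.a<b Y.b<c (shape-classmates shape in₁ in₂)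
                  (shape-classmates Y.shape in₁′ in₂′) (cong proj₁ eq) (cong proj₂ eq) disj

cliquePartition-colorable : ∀ {n q} (G : SimpleGraph n) (comp : Fin n → Fin q) →
  (∀ u v → u ≢ v → comp u ≡ comp v → adj G u v ≡ true) → (∀ i → classSize comp i ≤ 3) →
  Σ ℕ λ k → k + n ≤ edgeCount G + q × Colorable (P2Sub G) (DisjointP2 G) k
cliquePartition-colorable {n} {q} G comp clique small =
  K , bound , color G comp clique small , color-proper G comp clique small
  where
  K : ℕ
  K = length (nonFreeEdges G comp clique)
  bound : K + n ≤ edgeCount G + q
  bound = begin
      K + n
    ≤⟨ +-monoʳ-≤ K (n≤freeCount+q comp) ⟩
      K + (freeCount comp + q)
    ≡⟨ +-assoc K _ q ⟨
      K + freeCount comp + q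
    ≡⟨ cong (_+ q) (edgeCount≡nonFree+free G comp clique) ⟨
      edgeCount G + q ∎
    where open ≤-Reasoning

colorable-≤ : ∀ {V : Set} {Adj : V → V → Set} {k m} → k ≤ m → Colorable V Adj k → Colorable V Adj m
colorable-≤ k≤m (c , proper) = (λ x → inject≤ (c x) k≤m) ,
  λ x y adj-xy same → proper x y adj-xy (inject≤-injective k≤m k≤m (c x) (c y) same)

∑-classSize : ∀ {n q} (comp : Fin n → Fin q) → ∑[ i < q ] classSize comp i ≡ n
∑-classSize {n} {q} comp = begin
    ∑[ i < q ] classSize comp i
  ≡⟨ sum-cong-≗ {q} (λ i → length-filter-tabulate (λ v → comp v ≟ᶠ i) id) ⟩
    ∑[ i < q ] ∑[ v < n ] 𝟙 (comp v ≟ᶠ i)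
  ≡⟨ ∑-comm {q} {n} _ ⟩
    ∑[ v < n ] ∑[ i < q ] 𝟙 (comp v ≟ᶠ i)
  ≡⟨ sum-cong-≗ {n} (λ v → ∑-𝟙-≟ˡ q (comp v)) ⟩
    ∑[ v < n ] 1
  ≡⟨ trans (∑-const n 1) (*-identityʳ n) ⟩
    n ∎
  where open ≡-Reasoning

2*q+k≤n : ∀ {n q} (comp : Fin n → Fin q) k → k ≤ q → (∀ i → 2 ≤ classSize comp i) →
          (∀ i → toℕ i < k → 3 ≤ classSize comp i) → 2 * q + k ≤ n
2*q+k≤n {n} {q} comp k k≤q ≥2 ≥3 = begin
    2 * q + k
  ≡⟨ cong₂ _+_ (trans (*-comm 2 q) (sym (∑-const q 2))) (sym (count-below q k k≤q)) ⟩
    ∑[ i < q ] 2 + ∑[ i < q ] 𝟙 (toℕ i <? k)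
  ≡⟨ ∑-distrib-+ {q} _ _ ⟨
    ∑[ i < q ] (2 + 𝟙 (toℕ i <? k))
  ≤⟨ ∑-mono-≤ lower ⟩
    ∑[ i < q ] classSize comp i
  ≡⟨ ∑-classSize comp ⟩
    n ∎
  where
  open ≤-Reasoning
  count-below : ∀ N k → k ≤ N → ∑[ i < N ] 𝟙 (toℕ i <? k) ≡ k
  count-below N       zero    _         = ∑-zero {N} λ i → 𝟙-no (toℕ i <? 0) λ ()
  count-below (suc N) (suc k) (s≤s k≤N) = cong suc (trans
    (sum-cong-≗ {N} λ i → 𝟙-cong (suc (toℕ i) <? suc k) (toℕ i <? k) s≤s⁻¹ s≤s) (count-below N k k≤N))
  lower : ∀ i → 2 + 𝟙 (toℕ i <? k) ≤ classSize comp i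
  lower i = by-case (toℕ i <? k)
    where
    by-case : (d : Dec (toℕ i < k)) → 2 + 𝟙 d ≤ classSize comp i
    by-case (yes i<k) = ≥3 i i<k
    by-case (no _)    = ≥2 i

⌊2n/3⌋+1+p≤n : ∀ n p → 3 * p < n → (2 * n) / 3 + suc p ≤ n
⌊2n/3⌋+1+p≤n n p 3p<n = begin
    (2 * n) / 3 + suc p
  ≡⟨ +-suc _ p ⟩
    suc ((2 * n) / 3) + p
  ≤⟨ +-monoˡ-≤ p (m<n*o⇒m/o<n 2n<[n∸p]*3) ⟩
    (n ∸ p) + p
  ≡⟨ m∸n+n≡m p≤n ⟩
    n ∎
  where
  open ≤-Reasoning
  p≤n : p ≤ n
  p≤n = ≤-trans (m≤n*m p 3) (<⇒≤ 3p<n)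
  2n<[n∸p]*3 : 2 * n < (n ∸ p) * 3
  2n<[n∸p]*3 = +-cancelʳ-< (3 * p) (2 * n) ((n ∸ p) * 3) (begin-strict
      2 * n + 3 * p
    <⟨ +-monoʳ-< (2 * n) 3p<n ⟩
      2 * n + n
    ≡⟨ cong (λ m → 2 * m + m) (m∸n+n≡m p≤n) ⟨
      2 * (n ∸ p + p) + (n ∸ p + p)
    ≡⟨ solve 2 (λ d p → con 2 :* (d :+ p) :+ (d :+ p) := d :* con 3 :+ con 3 :* p) refl (n ∸ p) p ⟩
      (n ∸ p) * 3 + 3 * p ∎)

a∸⌊b/3⌋≤m : ∀ a m b → 3 * a ≤ 3 * m + b → a ∸ b / 3 ≤ m
a∸⌊b/3⌋≤m a m b 3a≤3m+b = m≤n+o⇒m∸n≤o a (b / 3) (begin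
    a
  ≤⟨ m≤n+m∸n a m ⟩
    m + (a ∸ m)
  ≤⟨ +-monoʳ-≤ m a∸m≤b/3 ⟩
    m + b / 3
  ≡⟨ +-comm m _ ⟩
    b / 3 + m ∎)
  where
  open ≤-Reasoning
  [a∸m]*3≤b : (a ∸ m) * 3 ≤ b
  [a∸m]*3≤b = subst (_≤ b) (trans (sym (*-distribˡ-∸ 3 a m)) (*-comm 3 (a ∸ m)))
                    (m≤n+o⇒m∸n≤o (3 * a) (3 * m) 3a≤3m+b)
  a∸m≤b/3 : a ∸ m ≤ b / 3
  a∸m≤b/3 = subst (_≤ b / 3) (m*n/n≡m (a ∸ m) 3) (/-monoˡ-≤ 3 [a∸m]*3≤b)

module _ {n p : ℕ} (comp : Fin n → Fin (suc (suc p)))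
         (size≡3 : ∀ i → toℕ i < p → classSize comp i ≡ 3)
         (size∈23 : ∀ i → p ≤ toℕ i → classSize comp i ≡ 2 ⊎ classSize comp i ≡ 3) where

  classSize∈23 : ∀ i → classSize comp i ≡ 2 ⊎ classSize comp i ≡ 3
  classSize∈23 i with toℕ i <? p
  ... | yes i<p = inj₂ (size≡3 i i<p)
  ... | no i≮p  = size∈23 i (≮⇒≥ i≮p)

  classSize≤3 : ∀ i → classSize comp i ≤ 3
  classSize≤3 i with classSize∈23 i
  ... | inj₁ s≡2 rewrite s≡2 = n≤1+n 2
  ... | inj₂ s≡3 rewrite s≡3 = ≤-refl

  2≤classSize : ∀ i → 2 ≤ classSize comp i
  2≤classSize i with classSize∈23 i
  ... | inj₁ s≡2 rewrite s≡2 = ≤-refl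
  ... | inj₂ s≡3 rewrite s≡3 = n≤1+n 2

  3*[1+p]<n : 3 * suc p < n
  3*[1+p]<n = subst (_≤ n) (solve 1 (λ p → con 2 :* (con 2 :+ p) :+ p := con 1 :+ con 3 :* (con 1 :+ p)) refl p)
                    (2*q+k≤n comp p (≤-trans (n≤1+n p) (n≤1+n (suc p))) 2≤classSize
                      λ i i<p → ≤-reflexive (sym (size≡3 i i<p)))

cliqueFactor-colorable : ∀ {n} (G : SimpleGraph n) p → 1 ≤ p → HasCliqueFactor G p →
  Σ ℕ λ k → k + (2 * n) / 3 ≤ edgeCount G × Colorable (P2Sub G) (DisjointP2 G) k
cliqueFactor-colorable {n} G (suc p) _ (H , comp , H⊆G , _ , H-clique , size≡3 , size∈23)
  with cliquePartition-colorable G comp (λ u v u≢v same → H⊆G u v (H-clique u v u≢v same))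
                                  (classSize≤3 comp size≡3 size∈23)
... | k , k+n≤E+q , coloring = k , +-cancelʳ-≤ q _ _ k+t+q≤E+q , coloring
  where
  q = suc (suc p)
  t = (2 * n) / 3
  k+t+q≤E+q : k + t + q ≤ edgeCount G + q
  k+t+q≤E+q = begin
      k + t + q   ≡⟨ +-assoc k t q ⟩
      k + (t + q) ≤⟨ +-monoʳ-≤ k (⌊2n/3⌋+1+p≤n n (suc p) (3*[1+p]<n comp size≡3 size∈23)) ⟩
      k + n       ≤⟨ k+n≤E+q ⟩
      edgeCount G + q ∎
    where open ≤-Reasoning

mainTheorem7 : (n : ℕ) → (G : SimpleGraph n) → (p : ℕ) → 1 ≤ p →
    HasCliqueFactor G p →
    Σ ℕ λ χ → IsChromaticNumber (P2Sub G) (DisjointP2 G) χ ×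
      χ + (2 * n) / 3 ≡ edgeCount G
mainTheorem7 n G p 1≤p factor with cliqueFactor-colorable G p 1≤p factor
... | k , k+t≤E , coloring =
  edgeCount G ∸ t , (colorable-≤ (m+n≤o⇒m≤o∸n k k+t≤E) coloring , minimal) , m∸n+n≡m t≤E
  where
  t = (2 * n) / 3
  t≤E : t ≤ edgeCount G
  t≤E = ≤-trans (m≤n+m t k) k+t≤E
  minimal : ∀ m → Colorable (P2Sub G) (DisjointP2 G) m → edgeCount G ∸ t ≤ m
  minimal m coloring′ = a∸⌊b/3⌋≤m (edgeCount G) m (2 * n) (3*edgeCount≤3*m+2*n m G coloring′)
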